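{- Let $n>1$ and $k\ge1$, and let $\mathcal{B}=\{\mathcal{B}^{(0)},\mathcal{B}^{(1)},\mathcal{B}^{(2)}\}$ be a special $n$-Brinkhuis $k$-triple such that some word $w_1^{(0)}\in\mathcal{B}^{(0)}$ starts with the letters $01$. Then $n\ge 7$, and every word in $\mathcal{B}^{(0)}$ starts with the three letters $012$ and ends with the three letters $210$.
   Context: Words are over $\{0,1,2\}$; a word is square-free if it cannot be written as $xyyz$ with $y$ nonempty. For a word $w$, $\bar w$ is its reversal. Let $\tau$ be the letter permutation $0\mapsto1,1\mapsto2,2\mapsto0$, applied letterwise to words and elementwise to sets. An $n$-Brinkhuis $(k_0,k_1,k_2)$-triple is a family of sets $\mathcal{B}^{(0)},\mathcal{B}^{(1)},\mathcal{B}^{(2)}$ of square-free words of length $n$, $|\mathcal{B}^{(i)}|=k_i\ge1$, all $k_0+k_1+k_2$ words pairwise distinct, such that for every square-free word $ii'i''$ of length 3 and all $w\in\mathcal{B}^{(i)},w'\in\mathcal{B}^{(i')},w''\in\mathcal{B}^{(i'')}$ the word $ww'w''$ is square-free. A special $n$-Brinkhuis $k$-triple is an $n$-Brinkhuis $(k,k,k)$-triple with $\mathcal{B}^{(2)}=\tau(\mathcal{B}^{(1)})=\tau^2(\mathcal{B}^{(0)})$ and such that $w\in\mathcal{B}^{(0)}$ implies $\bar w\in\mathcal{B}^{(0)}$. -}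

module Defs where

open import Data.Fin using (Fin; zero; suc)
open import Data.List using (List; []; _∷_; _++_; length; reverse; map)
open import Data.List.Membership.Propositional using (_∈_)
open import Data.List.Relation.Unary.Unique.Propositional using (Unique)
open import Data.Product using (∃; ∃-syntax; _×_; Σ)
open import Relation.Binary.PropositionalEquality using (_≡_; _≢_)
open import Relation.Nullary using (¬_)
open import Function.Bundles using (_⇔_)
open import Data.Nat using (ℕ; _≥_)

Letter : Set
Letter = Fin 3

Word : Set
Word = List Letter

l0 l1 l2 : Letter
l0 = zero
l1 = suc zero
l2 = suc (suc zero)

SquareFree : Word → Set
SquareFree w = ¬ (∃[ x ] ∃[ y ] ∃[ z ] (y ≢ [] × w ≡ x ++ y ++ y ++ z))

τ : Letter → Letter
τ zero = suc zero
τ (suc zero) = suc (suc zero)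
τ (suc (suc zero)) = zero

τw : Word → Word
τw = map τ

-- finite sets of words, represented as duplicate-free lists
-- "S is the image of T under f" as sets
IsImage : (Word → Word) → List Word → List Word → Set
IsImage f T S = ∀ w → (w ∈ S) ⇔ (∃[ u ] (u ∈ T × f u ≡ w))

Sel : List Word → List Word → List Word → Letter → List Word
Sel B0 B1 B2 zero = B0
Sel B0 B1 B2 (suc zero) = B1
Sel B0 B1 B2 (suc (suc zero)) = B2

record BrinkhuisTriple (n k0 k1 k2 : ℕ) (B0 B1 B2 : List Word) : Set where
  field
    card0 : length B0 ≡ k0
    card1 : length B1 ≡ k1
    card2 : length B2 ≡ k2
    pos0 : k0 ≥ 1
    pos1 : k1 ≥ 1
    pos2 : k2 ≥ 1
    distinct : Unique (B0 ++ B1 ++ B2)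
    wordsLen : ∀ i w → w ∈ Sel B0 B1 B2 i → length w ≡ n
    wordsSF : ∀ i w → w ∈ Sel B0 B1 B2 i → SquareFree w
    concatSF : ∀ i i' i'' → SquareFree (i ∷ i' ∷ i'' ∷ []) →
      ∀ w w' w'' → w ∈ Sel B0 B1 B2 i → w' ∈ Sel B0 B1 B2 i' → w'' ∈ Sel B0 B1 B2 i'' →
      SquareFree (w ++ w' ++ w'')

record SpecialBrinkhuisTriple (n k : ℕ) (B0 B1 B2 : List Word) : Set where
  field
    triple : BrinkhuisTriple n k k k B0 B1 B2
    img1 : IsImage τw B0 B1
    img2 : IsImage τw B1 B2
    img2' : IsImage (λ w → τw (τw w)) B0 B2
    revClosed : ∀ w → w ∈ B0 → reverse w ∈ B0

{-# OPTIONS --safe #-}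
module Submission where

-- Reversal commutes with τ and B⁽⁰⁾ is closed under reversal, so from
-- w₁ = 01⋯ ∈ B⁽⁰⁾ we get the words τ(w̄₁) = ⋯21 ∈ B⁽¹⁾ and τ²(w̄₁) = ⋯02 ∈ B⁽²⁾.
-- Placing them in front of any v ∈ B⁽⁰⁾ (the patterns 101 and 202 are
-- square-free) rules out every prefix of v other than 012, and closure under
-- reversal turns this into the suffix 210.  The only overlap of the two, 01210,
-- dies in 01210·20102·01210, and 012210 contains 22.

open import Defs
open import Data.Fin using (zero; suc)
open import Data.Nat using (ℕ; _>_; _≥_; _≤_; s≤s)
open import Data.List using (List; []; _∷_; _++_; _ʳ++_; reverse; length)
open import Data.List.Properties
  using (++-assoc; ∷-injectiveʳ; ʳ++-defn; reverse-map; reverse-selfInverse; length-++-≤ʳ)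
open import Data.List.Membership.Propositional using (_∈_)
open import Data.Product using (∃-syntax; _×_; _,_)
open import Data.Sum using (_⊎_; inj₁; inj₂)
open import Data.Empty using (⊥-elim)
open import Relation.Nullary using (¬_)
open import Relation.Binary.PropositionalEquality
  using (_≡_; _≢_; refl; sym; trans; cong; subst; ≢-sym; module ≡-Reasoning)
open import Function.Bundles using (Equivalence)

square⇒¬SquareFree : ∀ x y {z} → y ≢ [] → ¬ SquareFree (x ++ y ++ y ++ z)
square⇒¬SquareFree x y {z} y≢[] sf = sf (x , y , z , y≢[] , refl)

SquareFree-++⁻ʳ : ∀ xs {ys} → SquareFree (xs ++ ys) → SquareFree ys
SquareFree-++⁻ʳ xs sf (x , y , z , y≢[] , refl) =
  sf (xs ++ x , y , z , y≢[] , sym (++-assoc xs x (y ++ y ++ z)))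

SquareFree-++⁻ˡ : ∀ xs {ys} → SquareFree (xs ++ ys) → SquareFree xs
SquareFree-++⁻ˡ _ {ys} sf (x , y , z , y≢[] , refl) = sf (x , y , z ++ ys , y≢[] , shift)
  where
  open ≡-Reasoning
  shift : (x ++ y ++ y ++ z) ++ ys ≡ x ++ y ++ y ++ z ++ ys
  shift = begin
    (x ++ y ++ y ++ z) ++ ys   ≡⟨ ++-assoc x _ ys ⟩
    x ++ (y ++ y ++ z) ++ ys   ≡⟨ cong (x ++_) (++-assoc y _ ys) ⟩
    x ++ y ++ (y ++ z) ++ ys   ≡⟨ cong (λ t → x ++ y ++ t) (++-assoc y z ys) ⟩
    x ++ y ++ y ++ z ++ ys     ∎

SquareFree-ʳ++⁻ʳ : ∀ xs {ys} → SquareFree (xs ʳ++ ys) → SquareFree ys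
SquareFree-ʳ++⁻ʳ xs sf = SquareFree-++⁻ʳ (reverse xs) (subst SquareFree (ʳ++-defn xs) sf)

SquareFree-∷ : ∀ {a w} → (∀ y z → y ≢ [] → a ∷ w ≢ y ++ y ++ z) →
               SquareFree w → SquareFree (a ∷ w)
SquareFree-∷ noSquarePrefix _ ([] , y , z , y≢[] , eq) = noSquarePrefix y z y≢[] eq
SquareFree-∷ _ sf (_ ∷ x , y , z , y≢[] , eq) = sf (x , y , z , y≢[] , ∷-injectiveʳ eq)

SquareFree-[] : SquareFree []
SquareFree-[] ([] , [] , _ , y≢[] , _) = y≢[] refl
SquareFree-[] ([] , _ ∷ _ , _ , _ , ())

SquareFree-[a] : ∀ {a} → SquareFree (a ∷ [])
SquareFree-[a] = SquareFree-∷ noSquarePrefix SquareFree-[]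
  where
  noSquarePrefix : ∀ {a} y z → y ≢ [] → a ∷ [] ≢ y ++ y ++ z
  noSquarePrefix [] _ y≢[] _ = y≢[] refl
  noSquarePrefix (_ ∷ []) _ _ ()
  noSquarePrefix (_ ∷ _ ∷ _) _ _ ()

SquareFree-[ab] : ∀ {a b} → a ≢ b → SquareFree (a ∷ b ∷ [])
SquareFree-[ab] a≢b = SquareFree-∷ (noSquarePrefix a≢b) SquareFree-[a]
  where
  noSquarePrefix : ∀ {a b} → a ≢ b → ∀ y z → y ≢ [] → a ∷ b ∷ [] ≢ y ++ y ++ z
  noSquarePrefix _   [] _ y≢[] _ = y≢[] refl
  noSquarePrefix a≢b (_ ∷ []) _ _ refl = a≢b refl
  noSquarePrefix _   (_ ∷ _ ∷ []) _ _ ()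
  noSquarePrefix _   (_ ∷ _ ∷ _ ∷ _) _ _ ()

SquareFree-[abc] : ∀ {a b c} → a ≢ b → b ≢ c → SquareFree (a ∷ b ∷ c ∷ [])
SquareFree-[abc] a≢b b≢c = SquareFree-∷ (noSquarePrefix a≢b) (SquareFree-[ab] b≢c)
  where
  noSquarePrefix : ∀ {a b c} → a ≢ b → ∀ y z → y ≢ [] → a ∷ b ∷ c ∷ [] ≢ y ++ y ++ z
  noSquarePrefix _   [] _ y≢[] _ = y≢[] refl
  noSquarePrefix a≢b (_ ∷ []) _ _ refl = a≢b refl
  noSquarePrefix _   (_ ∷ _ ∷ []) _ _ ()
  noSquarePrefix _   (_ ∷ _ ∷ _ ∷ []) _ _ ()
  noSquarePrefix _   (_ ∷ _ ∷ _ ∷ _ ∷ _) _ _ ()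

starts-with-012 : ∀ v → 2 ≤ length v →
  SquareFree (l2 ∷ l1 ∷ v) → SquareFree (l0 ∷ l2 ∷ v) → SquareFree (l2 ∷ l1 ∷ reverse v) →
  ∃[ r ] v ≡ l0 ∷ l1 ∷ l2 ∷ r
starts-with-012 (suc zero ∷ _) _ sf21 _ _ =
  ⊥-elim (square⇒¬SquareFree (l2 ∷ []) (l1 ∷ []) (λ ()) sf21)
starts-with-012 (suc (suc zero) ∷ _) _ _ sf02 _ =
  ⊥-elim (square⇒¬SquareFree (l0 ∷ []) (l2 ∷ []) (λ ()) sf02)
starts-with-012 (zero ∷ []) (s≤s ())
starts-with-012 (zero ∷ zero ∷ _) _ _ sf02 _ =
  ⊥-elim (square⇒¬SquareFree (l0 ∷ l2 ∷ []) (l0 ∷ []) (λ ()) sf02)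
starts-with-012 (zero ∷ suc (suc zero) ∷ _) _ _ sf02 _ =
  ⊥-elim (square⇒¬SquareFree [] (l0 ∷ l2 ∷ []) (λ ()) sf02)
starts-with-012 (zero ∷ suc zero ∷ []) _ _ _ sf21rev =
  ⊥-elim (square⇒¬SquareFree (l2 ∷ []) (l1 ∷ []) (λ ()) sf21rev)
starts-with-012 (zero ∷ suc zero ∷ zero ∷ _) _ sf21 _ _ =
  ⊥-elim (square⇒¬SquareFree (l2 ∷ []) (l1 ∷ l0 ∷ []) (λ ()) sf21)
starts-with-012 (zero ∷ suc zero ∷ suc zero ∷ _) _ sf21 _ _ =
  ⊥-elim (square⇒¬SquareFree (l2 ∷ l1 ∷ l0 ∷ []) (l1 ∷ []) (λ ()) sf21)
starts-with-012 (zero ∷ suc zero ∷ suc (suc zero) ∷ r) _ _ _ _ = r , refl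

012-prefix-210-suffix : ∀ r t → l0 ∷ l1 ∷ l2 ∷ r ≡ t ++ l2 ∷ l1 ∷ l0 ∷ [] →
  r ≡ l1 ∷ l0 ∷ [] ⊎ ∃[ u ] r ≡ u ++ l2 ∷ l1 ∷ l0 ∷ []
012-prefix-210-suffix _ [] ()
012-prefix-210-suffix _ (_ ∷ []) ()
012-prefix-210-suffix _ (_ ∷ _ ∷ []) refl = inj₁ refl
012-prefix-210-suffix _ (_ ∷ _ ∷ _ ∷ u) refl = inj₂ (u , refl)

framed-length≥7 : ∀ u → SquareFree (l0 ∷ l1 ∷ l2 ∷ u ++ l2 ∷ l1 ∷ l0 ∷ []) →
  7 ≤ length (l0 ∷ l1 ∷ l2 ∷ u ++ l2 ∷ l1 ∷ l0 ∷ [])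
framed-length≥7 [] sf = ⊥-elim (square⇒¬SquareFree (l0 ∷ l1 ∷ []) (l2 ∷ []) (λ ()) sf)
framed-length≥7 (_ ∷ u) _ = s≤s (s≤s (s≤s (s≤s (length-++-≤ʳ (l2 ∷ l1 ∷ l0 ∷ []) {u}))))

module BrinkhuisTripleProperties {n k₀ k₁ k₂ B0 B1 B2}
  (T : BrinkhuisTriple n k₀ k₁ k₂ B0 B1 B2) where
  open BrinkhuisTriple T

  ++-SquareFree : ∀ {i j x v} → i ≢ j → x ∈ Sel B0 B1 B2 i → v ∈ Sel B0 B1 B2 j →
                  SquareFree (x ++ v)
  ++-SquareFree {i} {j} {x} {v} i≢j x∈ v∈ = SquareFree-++⁻ˡ (x ++ v) (subst SquareFree
    (sym (++-assoc x v x))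
    (concatSF i j i (SquareFree-[abc] i≢j (≢-sym i≢j)) x v x x∈ v∈ x∈))

module SpecialBrinkhuisTripleProperties {n k B0 B1 B2}
  (S : SpecialBrinkhuisTriple n k B0 B1 B2) where
  open SpecialBrinkhuisTriple S
  open BrinkhuisTriple triple
  open BrinkhuisTripleProperties triple

  τw-∈-B1 : ∀ {w} → w ∈ B0 → τw w ∈ B1
  τw-∈-B1 {w} w∈ = Equivalence.from (img1 (τw w)) (w , w∈ , refl)

  τw²-∈-B2 : ∀ {w} → w ∈ B0 → τw (τw w) ∈ B2
  τw²-∈-B2 {w} w∈ = Equivalence.from (img2' (τw (τw w))) (w , w∈ , refl)

  reverse-τw-∈-B1 : ∀ {w} → w ∈ B0 → reverse (τw w) ∈ B1
  reverse-τw-∈-B1 {w} w∈ = subst (_∈ B1) (reverse-map τ w) (τw-∈-B1 (revClosed w w∈))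

  reverse-τw²-∈-B2 : ∀ {w} → w ∈ B0 → reverse (τw (τw w)) ∈ B2
  reverse-τw²-∈-B2 {w} w∈ = subst (_∈ B2) (reverse-map τ (τw w))
    (Equivalence.from (img2 _) (reverse (τw w) , reverse-τw-∈-B1 w∈ , refl))

  01210∉B0 : ¬ (l0 ∷ l1 ∷ l2 ∷ l1 ∷ l0 ∷ [] ∈ B0)
  01210∉B0 v∈ = square⇒¬SquareFree (l0 ∷ l1 ∷ l2 ∷ l1 ∷ []) (l0 ∷ l2 ∷ l0 ∷ l1 ∷ []) (λ ())
    (concatSF l0 l2 l0 (SquareFree-[abc] (λ ()) (λ ())) _ _ _ v∈ (τw²-∈-B2 v∈) v∈)

  module WithWordStarting01 (n>1 : n > 1) {u} (w₁∈ : l0 ∷ l1 ∷ u ∈ B0) where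

    -- reverse (τw w₁) ++ v unfolds to τw u ʳ++ (l2 ∷ l1 ∷ v), and similarly for τw².
    21-∷-SquareFree : ∀ {v} → v ∈ B0 → SquareFree (l2 ∷ l1 ∷ v)
    21-∷-SquareFree {v} v∈ = SquareFree-ʳ++⁻ʳ (τw u) (subst SquareFree
      (sym (ʳ++-defn (τw (l0 ∷ l1 ∷ u))))
      (++-SquareFree (λ ()) (reverse-τw-∈-B1 w₁∈) v∈))

    02-∷-SquareFree : ∀ {v} → v ∈ B0 → SquareFree (l0 ∷ l2 ∷ v)
    02-∷-SquareFree {v} v∈ = SquareFree-ʳ++⁻ʳ (τw (τw u)) (subst SquareFree
      (sym (ʳ++-defn (τw (τw (l0 ∷ l1 ∷ u)))))
      (++-SquareFree (λ ()) (reverse-τw²-∈-B2 w₁∈) v∈))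

    B0-starts-with-012 : ∀ {v} → v ∈ B0 → ∃[ r ] v ≡ l0 ∷ l1 ∷ l2 ∷ r
    B0-starts-with-012 {v} v∈ = starts-with-012 v
      (subst (2 ≤_) (sym (wordsLen l0 v v∈)) n>1)
      (21-∷-SquareFree v∈) (02-∷-SquareFree v∈) (21-∷-SquareFree (revClosed v v∈))

    B0-framed : ∀ v → v ∈ B0 →
      ∃[ u ] v ≡ (l0 ∷ l1 ∷ l2 ∷ []) ++ u ++ (l2 ∷ l1 ∷ l0 ∷ [])
    B0-framed v v∈ with B0-starts-with-012 v∈ | B0-starts-with-012 (revClosed v v∈)
    ... | r , refl | s , reverse-v≡
        with 012-prefix-210-suffix r (reverse s)
               (trans (sym (reverse-selfInverse reverse-v≡)) (ʳ++-defn s))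
    ... | inj₁ refl = ⊥-elim (01210∉B0 v∈)
    ... | inj₂ (u , refl) = u , refl

    n≥7 : n ≥ 7
    n≥7 with B0-framed _ w₁∈
    ... | u , w₁≡ = subst (7 ≤_) (wordsLen l0 _ w₁∈)
      (subst (λ w → 7 ≤ length w) (sym w₁≡)
        (framed-length≥7 u (subst SquareFree w₁≡ (wordsSF l0 _ w₁∈))))

lemma3 : (n k : ℕ) → n > 1 → k ≥ 1 → (B0 B1 B2 : List Word) →
    SpecialBrinkhuisTriple n k B0 B1 B2 →
    (∃[ w ] (w ∈ B0 × ∃[ u ] (w ≡ l0 ∷ l1 ∷ u))) →
    (n ≥ 7) × (∀ w → w ∈ B0 → ∃[ u ] (w ≡ (l0 ∷ l1 ∷ l2 ∷ []) ++ u ++ (l2 ∷ l1 ∷ l0 ∷ [])))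
lemma3 n k n>1 _ B0 B1 B2 S (_ , w₁∈ , _ , refl) = n≥7 , B0-framed
  where
  open SpecialBrinkhuisTripleProperties S
  open WithWordStarting01 n>1 w₁∈
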